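{- For any $\mathsf{T}$-term $P$ and any $*$-term $Q$, the unique $\mathsf{T}$-$*$-decomposition of $\mathrm{se}(P \wedge^{\circ} Q)$ is $(\mathrm{se}(P)[\mathsf{T}\mapsto\Box], \mathrm{se}(Q))$.
   Context: Let $A$ be a countable set of atoms. SCL-terms: $P ::= a \ (a\in A) \mid \mathsf{T} \mid \mathsf{F} \mid \neg P \mid (P \wedge^{\circ} P) \mid (P \vee^{\circ} P)$ (short-circuit left-sequential connectives). Subgrammars (with $a\in A$): $\mathsf{T}$-terms $P^{\mathsf{T}} ::= \mathsf{T} \mid (a \wedge^{\circ} P^{\mathsf{T}}) \vee^{\circ} P^{\mathsf{T}}$; $\mathsf{F}$-terms $P^{\mathsf{F}} ::= \mathsf{F} \mid (a \vee^{\circ} P^{\mathsf{F}}) \wedge^{\circ} P^{\mathsf{F}}$; $\ell$-terms $P^{\ell} ::= (a \wedge^{\circ} P^{\mathsf{T}}) \vee^{\circ} P^{\mathsf{F}} \mid (\neg a \wedge^{\circ} P^{\mathsf{T}}) \vee^{\circ} P^{\mathsf{F}}$; $*$-terms $P^* ::= P^c \mid P^d$, with $P^c ::= P^{\ell} \mid P^* \wedge^{\circ} P^d$ and $P^d ::= P^{\ell} \mid P^* \vee^{\circ} P^c$. $\mathcal{T}$ is the set of finite binary trees with leaves in $\{\mathsf{T},\mathsf{F}\}$: $\mathsf{T},\mathsf{F}\in\mathcal{T}$, $(X \trianglelefteq a \trianglerighteq Y)\in\mathcal{T}$ for $X,Y\in\mathcal{T}$, $a\in A$; $\mathcal{T}_{\Box}$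 is the analogous set with leaves in $\{\mathsf{T},\mathsf{F},\Box\}$. Leaf replacement $X[\ell\mapsto Y]$ replaces every leaf $\ell$ by $Y$, other leaves unchanged. Depth: $d(\text{leaf})=0$, $d(Y \trianglelefteq a \trianglerighteq Z) = 1+\max(d(Y),d(Z))$. $\mathrm{se}$: $\mathrm{se}(\mathsf{T}) = \mathsf{T}$, $\mathrm{se}(\mathsf{F}) = \mathsf{F}$, $\mathrm{se}(a) = \mathsf{T} \trianglelefteq a \trianglerighteq \mathsf{F}$, $\mathrm{se}(\neg P) = \mathrm{se}(P)[\mathsf{T}\mapsto\mathsf{F}, \mathsf{F}\mapsto\mathsf{T}]$, $\mathrm{se}(P \wedge^{\circ} Q) = \mathrm{se}(P)[\mathsf{T}\mapsto \mathrm{se}(Q)]$, $\mathrm{se}(P \vee^{\circ} Q) = \mathrm{se}(P)[\mathsf{F}\mapsto \mathrm{se}(Q)]$. For $X\in\mathcal{T}$, $(Y,Z)\in\mathcal{T}_{\Box}\times\mathcal{T}$ is a candidate $\mathsf{T}$-$*$-decomposition (ctsd) of $X$ if $X = Y[\Box\mapsto Z]$, $Y$ contains neither $\mathsf{T}$ nor $\mathsf{F}$, and there is no $(U,V)\in\mathcal{T}_{\Box}\times\mathcal{T}$ with $Z = U[\Box\mapsto V]$, $U$ containing $\Box$, $U\neq\Box$, and $U$ containing neither $\mathsf{T}$ nor $\mathsf{F}$. A $\mathsf{T}$-$*$-decomposition (tsd) of $X$ is a ctsd $(Y,Z)$ of $X$ such that no other ctsd $(Y',Z')$ of $X$ has $d(Z')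 < d(Z)$. -}

module Defs where

open import Data.Nat using (ℕ; suc; _⊔_; _<_)
open import Data.Product using (_×_; ∃; Σ; _,_)
open import Relation.Binary.PropositionalEquality using (_≡_)
open import Relation.Nullary using (¬_)

Atom : Set
Atom = ℕ

data Term : Set where
  atom : Atom → Term
  `T `F : Term
  ¬' : Term → Term
  _∧°_ _∨°_ : Term → Term → Term

data TTerm : Term → Set where
  tT : TTerm `T
  tStep : ∀ a {P Q} → TTerm P → TTerm Q → TTerm ((atom a ∧° P) ∨° Q)

data FTerm : Term → Set where
  fF : FTerm `F
  fStep : ∀ a {P Q} → FTerm P → FTerm Q → FTerm ((atom a ∨° P) ∧° Q)

data LTerm : Term → Set where
  lPos : ∀ a {P Q} → TTerm P → FTerm Q → LTerm ((atom a ∧° P) ∨° Q)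
  lNeg : ∀ a {P Q} → TTerm P → FTerm Q → LTerm ((¬' (atom a) ∧° P) ∨° Q)

mutual
  data StarTerm : Term → Set where
    sC : ∀ {P} → CTerm P → StarTerm P
    sD : ∀ {P} → DTerm P → StarTerm P

  data CTerm : Term → Set where
    cL : ∀ {P} → LTerm P → CTerm P
    cAnd : ∀ {P Q} → StarTerm P → DTerm Q → CTerm (P ∧° Q)

  data DTerm : Term → Set where
    dL : ∀ {P} → LTerm P → DTerm P
    dOr : ∀ {P Q} → StarTerm P → CTerm Q → DTerm (P ∨° Q)

-- Binary trees with leaves in L;  node X a Y  is  X ⊴ a ⊵ Y
data Tree (L : Set) : Set where
  leaf : L → Tree L
  node : Tree L → Atom → Tree L → Tree L

data TF : Set where
  lT lF : TF

data TFB : Set where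
  bT bF □ : TFB

𝒯 : Set
𝒯 = Tree TF

𝒯□ : Set
𝒯□ = Tree TFB

replace : ∀ {L M : Set} → Tree L → (L → Tree M) → Tree M
replace (leaf l) σ = σ l
replace (node X a Y) σ = node (replace X σ) a (replace Y σ)

depth : ∀ {L : Set} → Tree L → ℕ
depth (leaf _) = 0
depth (node Y a Z) = suc (depth Y ⊔ depth Z)

swapTF : TF → 𝒯
swapTF lT = leaf lF
swapTF lF = leaf lT

se : Term → 𝒯
se `T = leaf lT
se `F = leaf lF
se (atom a) = node (leaf lT) a (leaf lF)
se (¬' P) = replace (se P) swapTF
se (P ∧° Q) = replace (se P) σ
  where σ : TF → 𝒯
        σ lT = se Q
        σ lF = leaf lF
se (P ∨° Q) = replace (se P) σ
  where σ : TF → 𝒯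
        σ lT = leaf lT
        σ lF = se Q

boxSub : TFB → 𝒯 → 𝒯
boxSub bT Z = leaf lT
boxSub bF Z = leaf lF
boxSub □ Z = Z

_[□↦_] : 𝒯□ → 𝒯 → 𝒯
Y [□↦ Z ] = replace Y (λ l → boxSub l Z)

tToBox : TF → 𝒯□
tToBox lT = leaf □
tToBox lF = leaf bF

_[T↦□] : 𝒯 → 𝒯□
X [T↦□] = replace X tToBox

data HasLeaf {L : Set} (l : L) : Tree L → Set where
  here : HasLeaf l (leaf l)
  inl  : ∀ {X a Y} → HasLeaf l X → HasLeaf l (node X a Y)
  inr  : ∀ {X a Y} → HasLeaf l Y → HasLeaf l (node X a Y)

NoTF : 𝒯□ → Set
NoTF Y = ¬ HasLeaf bT Y × ¬ HasLeaf bF Y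

IsCTSD : 𝒯 → 𝒯□ → 𝒯 → Set
IsCTSD X Y Z =
  (X ≡ Y [□↦ Z ]) × NoTF Y ×
  ¬ (Σ 𝒯□ λ U → Σ 𝒯 λ V →
       (Z ≡ U [□↦ V ]) × HasLeaf □ U × ¬ (U ≡ leaf □) × NoTF U)

IsTSD : 𝒯 → 𝒯□ → 𝒯 → Set
IsTSD X Y Z =
  IsCTSD X Y Z ×
  (∀ Y' Z' → IsCTSD X Y' Z' → ¬ (depth Z' < depth Z))

module Submission where

-- Call a tree Z irreducible if it is not a node both of whose
-- children are tiled by copies of one common tree V.  Then:
--   (1) for box-only contexts Y, Y' (leaves all □) and irreducible Z, Z',
--       Y[□↦Z] ≡ Y'[□↦Z'] forces Y ≡ Y' and Z ≡ Z'; and the third clause of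
--       a candidate decomposition says exactly that Z is irreducible.  Hence a
--       tree of the form Y₀[□↦Z₀] with Y₀ box-only and Z₀ irreducible has
--       (Y₀, Z₀) as its unique T-*-decomposition (`unique-tsd`).
--   (2) substituting an irreducible W containing l for the label l in an
--       irreducible X gives an irreducible tree (`sub-irreducible`); the key
--       point is that this substitution is injective.
--   (3) by (2), se(Q) is irreducible and contains both T and F for every
--       *-term Q; the base case (ℓ-terms) holds because the two children of
--       the root have disjoint leaf labels.
--   (4) for a T-term P, se(P) has only T-leaves, so se(P)[T↦□] is box-only
--       and se(P ∧° Q) = se(P)[T↦□][□↦se(Q)].

open import Defs
open import Data.Empty using (⊥; ⊥-elim)
open import Data.Unit using (⊤; tt)
open import Data.Product using (_×_; Σ; _,_; proj₁; proj₂)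
open import Data.Nat using (_≤_; _<_; s≤s)
open import Data.Nat.Properties using (≤-reflexive; ≤-trans; m≤m⊔n; m≤n⊔m; m≤n⇒m≤1+n; <-irrefl)
open import Relation.Nullary using (¬_; yes; no)
open import Relation.Binary.Definitions using (DecidableEquality)
open import Relation.Binary.PropositionalEquality
  using (_≡_; _≢_; refl; sym; trans; cong; cong₂; subst)

leaf-injective : ∀ {L : Set} {l m : L} → leaf l ≡ leaf m → l ≡ m
leaf-injective refl = refl

node-injective : ∀ {L : Set} {A B A' B' : Tree L} {a a'} →
  node A a B ≡ node A' a' B' → A ≡ A' × a ≡ a' × B ≡ B'
node-injective refl = refl , refl , refl

leaf-of-leaf : ∀ {L : Set} {l m : L} → HasLeaf l (leaf m) → l ≡ m
leaf-of-leaf here = refl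

some-leaf : ∀ {L : Set} (X : Tree L) → Σ L λ l → HasLeaf l X
some-leaf (leaf l) = l , here
some-leaf (node X _ _) with some-leaf X
... | l , h = l , inl h

-- Replacement only depends on the values of σ (no function extensionality here).
replace-ext : ∀ {L M : Set} (X : Tree L) {σ τ : L → Tree M} →
  (∀ l → σ l ≡ τ l) → replace X σ ≡ replace X τ
replace-ext (leaf l) e = e l
replace-ext (node X a Y) e = cong₂ (λ u v → node u a v) (replace-ext X e) (replace-ext Y e)

leaf-of-replace : ∀ {L M : Set} {m : M} (X : Tree L) (σ : L → Tree M) →
  HasLeaf m (replace X σ) → Σ L λ l → HasLeaf l X × HasLeaf m (σ l)
leaf-of-replace (leaf l) σ h = l , here , h
leaf-of-replace (node X a Y) σ (inl h) with leaf-of-replace X σ h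
... | l , hX , hσ = l , inl hX , hσ
leaf-of-replace (node X a Y) σ (inr h) with leaf-of-replace Y σ h
... | l , hY , hσ = l , inr hY , hσ

leaf-into-replace : ∀ {L M : Set} {l : L} {m : M} {X : Tree L} (σ : L → Tree M) →
  HasLeaf l X → HasLeaf m (σ l) → HasLeaf m (replace X σ)
leaf-into-replace σ here h = h
leaf-into-replace σ (inl hX) h = inl (leaf-into-replace σ hX h)
leaf-into-replace σ (inr hX) h = inr (leaf-into-replace σ hX h)

replace-identity : ∀ {L : Set} (X : Tree L) (σ : L → Tree L) →
  (∀ {m} → HasLeaf m X → σ m ≡ leaf m) → replace X σ ≡ X
replace-identity (leaf l) σ fixes = fixes here
replace-identity (node X a Y) σ fixes =
  cong₂ (λ u v → node u a v) (replace-identity X σ (λ h → fixes (inl h))) (replace-identity Y σ (λ h → fixes (inr h)))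

replace-uniform : ∀ {L M : Set} {l : L} {k : M} (X : Tree L) (σ : L → Tree M) →
  (∀ {m} → HasLeaf m X → m ≡ l) → HasLeaf k (replace X σ) → HasLeaf k (σ l)
replace-uniform X σ only h with leaf-of-replace X σ h
... | m , hX , hσ with only hX
...   | refl = hσ

-- Tilings and irreducibility

data Tiled {L : Set} (V : Tree L) : Tree L → Set where
  copy : Tiled V V
  join : ∀ {A a B} → Tiled V A → Tiled V B → Tiled V (node A a B)

Irreducible : ∀ {L : Set} → Tree L → Set
Irreducible (leaf _) = ⊤
Irreducible (node A _ B) = ∀ {V} → Tiled V A → Tiled V B → ⊥

tiled-irreducible : ∀ {L : Set} {V Z : Tree L} → Irreducible Z → Tiled V Z → V ≡ Z
tiled-irreducible irr copy = refl
tiled-irreducible irr (join t u) = ⊥-elim (irr t u)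

tiling-leaf : ∀ {L : Set} {V X : Tree L} {m : L} → Tiled V X → HasLeaf m V → HasLeaf m X
tiling-leaf copy h = h
tiling-leaf (join t _) h = inl (tiling-leaf t h)

-- A node whose children carry different labels k ≢ k' only is irreducible:
-- any common tile would put one of its leaves on both sides.
separated : ∀ {L : Set} {A B : Tree L} {a} {k k' : L} → k ≢ k' →
  (∀ {m} → HasLeaf m A → m ≡ k) → (∀ {m} → HasLeaf m B → m ≡ k') →
  Irreducible (node A a B)
separated k≢k' onlyA onlyB {V} tA tB with some-leaf V
... | m , h = k≢k' (trans (sym (onlyA (tiling-leaf tA h))) (onlyB (tiling-leaf tB h)))

-- Substitution of a tree for a single label

module Substitution {L : Set} (_≟_ : DecidableEquality L) where

  at : L → Tree L → L → Tree L
  at l W m with l ≟ m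
  ... | yes _ = W
  ... | no _ = leaf m

  sub : L → Tree L → Tree L → Tree L
  sub l W X = replace X (at l W)

  Full : Tree L → Set
  Full X = ∀ m → HasLeaf m X

  at-self : ∀ {l W} → at l W l ≡ W
  at-self {l} with l ≟ l
  ... | yes _ = refl
  ... | no l≢l = ⊥-elim (l≢l refl)

  at-other : ∀ {l W m} → l ≢ m → at l W m ≡ leaf m
  at-other {l} {W} {m} l≢m with l ≟ m
  ... | yes l≡m = ⊥-elim (l≢m l≡m)
  ... | no _ = refl

  at-has : ∀ {l W m} → HasLeaf l (at l W m) → l ≡ m
  at-has {l} {W} {m} h with l ≟ m
  ... | yes l≡m = l≡m
  ... | no _ = leaf-of-leaf h

  at-irreducible : ∀ {l W m} → Irreducible W → Irreducible (at l W m)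
  at-irreducible {l} {W} {m} irr with l ≟ m
  ... | yes _ = irr
  ... | no _ = tt

  depth-sub : ∀ {l W X} → HasLeaf l X → depth W ≤ depth (sub l W X)
  depth-sub {l} {W} here = ≤-reflexive (cong depth (sym (at-self {l} {W})))
  depth-sub {X = node A _ B} (inl h) =
    m≤n⇒m≤1+n (≤-trans (depth-sub h) (m≤m⊔n _ (depth (sub _ _ B))))
  depth-sub {X = node A _ B} (inr h) =
    m≤n⇒m≤1+n (≤-trans (depth-sub h) (m≤n⊔m (depth (sub _ _ A)) _))

  sub-node-deeper : ∀ {l W A b B} → HasLeaf l (node A b B) →
    depth W < depth (sub l W (node A b B))
  sub-node-deeper {B = B} (inl h) = s≤s (≤-trans (depth-sub h) (m≤m⊔n _ (depth (sub _ _ B))))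
  sub-node-deeper {A = A} (inr h) = s≤s (≤-trans (depth-sub h) (m≤n⊔m (depth (sub _ _ A)) _))

  -- W cannot reappear strictly below itself: if l occurs in W, then W is not
  -- the substitution of W into a node (that would be deeper than W).
  sub-not-self : ∀ {l W A b B} → HasLeaf l W → W ≢ sub l W (node A b B)
  sub-not-self {l} {W} {A} {b} {B} h e
    with leaf-of-replace (node A b B) (at l W) (subst (HasLeaf l) e h)
  ... | m , hm , hl with at-has {l} {W} hl
  ...   | refl = <-irrefl (cong depth e) (sub-node-deeper hm)

  -- at l W is injective when l occurs in W (W is then not a foreign leaf).
  at-injective : ∀ {l W m m'} → HasLeaf l W → at l W m ≡ at l W m' → m ≡ m'
  at-injective {l} {W} {m} {m'} h e with l ≟ m | l ≟ m'
  ... | yes refl | yes refl = refl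
  ... | yes refl | no l≢m' = ⊥-elim (l≢m' (leaf-of-leaf (subst (HasLeaf l) e h)))
  ... | no l≢m | yes refl = ⊥-elim (l≢m (leaf-of-leaf (subst (HasLeaf l) (sym e) h)))
  ... | no _ | no _ = leaf-injective e

  at-not-node : ∀ {l W m A b B} → HasLeaf l W → at l W m ≢ sub l W (node A b B)
  at-not-node {l} {W} {m} {A} {b} {B} h with l ≟ m
  ... | yes refl = sub-not-self {A = A} {b} {B} h
  ... | no _ = λ ()

  sub-injective : ∀ {l W} → HasLeaf l W → ∀ X X' → sub l W X ≡ sub l W X' → X ≡ X'
  sub-injective h (leaf m) (leaf m') e = cong leaf (at-injective h e)
  sub-injective h (leaf m) (node A b B) e = ⊥-elim (at-not-node {A = A} {b} {B} h e)
  sub-injective h (node A b B) (leaf m) e = ⊥-elim (at-not-node {A = A} {b} {B} h (sym e))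
  sub-injective h (node A b B) (node A' b' B') e with node-injective e
  ... | eA , refl , eB = cong₂ (λ u v → node u b v) (sub-injective h A A' eA) (sub-injective h B B' eB)

  lift-tiling : ∀ {l W V} → HasLeaf l W → Irreducible W → ∀ X →
    Tiled V (sub l W X) → Σ (Tree L) λ V₁ → Tiled V₁ X × sub l W V₁ ≡ V
  lift-tiling h irr (leaf m) t = leaf m , copy , sym (tiled-irreducible (at-irreducible irr) t)
  lift-tiling h irr (node X₁ a X₂) copy = node X₁ a X₂ , copy , refl
  lift-tiling h irr (node X₁ a X₂) (join t₁ t₂)
    with lift-tiling h irr X₁ t₁ | lift-tiling h irr X₂ t₂
  ... | V₁ , u₁ , e₁ | V₂ , u₂ , e₂ with sub-injective h V₁ V₂ (trans e₁ (sym e₂))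
  ...   | refl = V₁ , join u₁ u₂ , e₁

  sub-irreducible : ∀ {l W} → HasLeaf l W → Irreducible W →
    ∀ X → Irreducible X → Irreducible (sub l W X)
  sub-irreducible h irrW (leaf m) _ = at-irreducible irrW
  sub-irreducible h irrW (node X₁ b X₂) irrX t₁ t₂
    with lift-tiling h irrW X₁ t₁ | lift-tiling h irrW X₂ t₂
  ... | V₁ , u₁ , e₁ | V₂ , u₂ , e₂ with sub-injective h V₁ V₂ (trans e₁ (sym e₂))
  ...   | refl = irrX u₁ u₂

  -- Every label survives: l through W, the others unchanged.
  sub-full : ∀ {l W} X → Full X → Full W → Full (sub l W X)
  sub-full {l} {W} X fX fW m with l ≟ m
  ... | yes refl = leaf-into-replace (at l W) (fX l) (subst (HasLeaf l) (sym (at-self {l} {W})) (fW l))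
  ... | no l≢m = leaf-into-replace (at l W) (fX m) (subst (HasLeaf m) (sym (at-other l≢m)) here)

  FullIrreducible : Tree L → Set
  FullIrreducible X = Full X × Irreducible X

  sub-full-irreducible : ∀ {l W} X → FullIrreducible X → FullIrreducible W →
    FullIrreducible (sub l W X)
  sub-full-irreducible {l} X (fX , iX) (fW , iW) = sub-full X fX fW , sub-irreducible (fW l) iW X iX

-- Box-only contexts and T-*-decompositions

data BoxOnly : 𝒯□ → Set where
  box : BoxOnly (leaf □)
  join : ∀ {U₁ a U₂} → BoxOnly U₁ → BoxOnly U₂ → BoxOnly (node U₁ a U₂)

-- BoxOnly is the inductive form of the condition NoTF.
noTF→boxOnly : ∀ {U} → NoTF U → BoxOnly U
noTF→boxOnly {leaf bT} (noT , _) = ⊥-elim (noT here)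
noTF→boxOnly {leaf bF} (_ , noF) = ⊥-elim (noF here)
noTF→boxOnly {leaf □} _ = box
noTF→boxOnly {node U₁ a U₂} (noT , noF) =
  join (noTF→boxOnly ((λ h → noT (inl h)) , (λ h → noF (inl h))))
       (noTF→boxOnly ((λ h → noT (inr h)) , (λ h → noF (inr h))))

boxOnly→noTF : ∀ {U} → BoxOnly U → NoTF U
boxOnly→noTF box = (λ ()) , (λ ())
boxOnly→noTF (join u₁ u₂) with boxOnly→noTF u₁ | boxOnly→noTF u₂
... | noT₁ , noF₁ | noT₂ , noF₂ =
  (λ { (inl h) → noT₁ h ; (inr h) → noT₂ h }) , (λ { (inl h) → noF₁ h ; (inr h) → noF₂ h })

boxOnly-hasBox : ∀ {U} → BoxOnly U → HasLeaf □ U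
boxOnly-hasBox box = here
boxOnly-hasBox (join u₁ _) = inl (boxOnly-hasBox u₁)

boxOnly-tiled : ∀ {U V} → BoxOnly U → Tiled V (U [□↦ V ])
boxOnly-tiled box = copy
boxOnly-tiled (join u₁ u₂) = join (boxOnly-tiled u₁) (boxOnly-tiled u₂)

tiled-boxOnly : ∀ {V X} → Tiled V X → Σ 𝒯□ λ U → BoxOnly U × X ≡ U [□↦ V ]
tiled-boxOnly copy = leaf □ , box , refl
tiled-boxOnly (join {a = a} t₁ t₂) with tiled-boxOnly t₁ | tiled-boxOnly t₂
... | U₁ , u₁ , e₁ | U₂ , u₂ , e₂ = node U₁ a U₂ , join u₁ u₂ , cong₂ (λ x y → node x a y) e₁ e₂

boxOnly-reducible : ∀ {U V} → BoxOnly U → U ≢ leaf □ → ¬ Irreducible (U [□↦ V ])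
boxOnly-reducible box U≢□ _ = U≢□ refl
boxOnly-reducible (join u₁ u₂) _ irr = irr (boxOnly-tiled u₁) (boxOnly-tiled u₂)

-- The decompositions excluded by the third clause of a candidate decomposition.
Splittable : 𝒯 → Set
Splittable Z = Σ 𝒯□ λ U → Σ 𝒯 λ V →
  (Z ≡ U [□↦ V ]) × HasLeaf □ U × ¬ (U ≡ leaf □) × NoTF U

irreducible→unsplittable : ∀ {Z} → Irreducible Z → ¬ Splittable Z
irreducible→unsplittable irr (U , V , e , _ , U≢□ , noTF) =
  boxOnly-reducible (noTF→boxOnly noTF) U≢□ (subst Irreducible e irr)

unsplittable→irreducible : ∀ {Z} → ¬ Splittable Z → Irreducible Z
unsplittable→irreducible {leaf _} _ = tt
unsplittable→irreducible {node A a B} unsplit {V} t₁ t₂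
  with tiled-boxOnly t₁ | tiled-boxOnly t₂
... | U₁ , u₁ , e₁ | U₂ , u₂ , e₂ =
  unsplit (node U₁ a U₂ , V , cong₂ (λ x y → node x a y) e₁ e₂ ,
           boxOnly-hasBox (join u₁ u₂) , (λ ()) , boxOnly→noTF (join u₁ u₂))

decomposition-unique : ∀ {Y Y' Z Z'} → BoxOnly Y → BoxOnly Y' →
  Irreducible Z → Irreducible Z' → Y [□↦ Z ] ≡ Y' [□↦ Z' ] → Y ≡ Y' × Z ≡ Z'
decomposition-unique box box _ _ e = refl , e
decomposition-unique {Z' = Z'} box y'@(join _ _) irr _ e =
  ⊥-elim (boxOnly-reducible {V = Z'} y' (λ ()) (subst Irreducible e irr))
decomposition-unique {Z = Z} y@(join _ _) box _ irr' e =
  ⊥-elim (boxOnly-reducible {V = Z} y (λ ()) (subst Irreducible (sym e) irr'))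
decomposition-unique (join {a = b} y₁ y₂) (join y₁' y₂') irr irr' e with node-injective e
... | e₁ , refl , e₂ with decomposition-unique y₁ y₁' irr irr' e₁ | decomposition-unique y₂ y₂' irr irr' e₂
...   | refl , Z≡Z' | refl , _ = refl , Z≡Z'

unique-tsd : ∀ X Y₀ Z₀ → BoxOnly Y₀ → Irreducible Z₀ → X ≡ Y₀ [□↦ Z₀ ] →
  IsTSD X Y₀ Z₀ × (∀ Y Z → IsTSD X Y Z → (Y ≡ Y₀) × (Z ≡ Z₀))
unique-tsd X Y₀ Z₀ y₀ z₀ split = (candidate , minimal) , (λ Y Z tsd → only Y Z (proj₁ tsd))
  where
    candidate : IsCTSD X Y₀ Z₀
    candidate = split , boxOnly→noTF y₀ , irreducible→unsplittable z₀

    only : ∀ Y Z → IsCTSD X Y Z → (Y ≡ Y₀) × (Z ≡ Z₀)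
    only Y Z (e , noTF , unsplit) =
      decomposition-unique (noTF→boxOnly noTF) y₀ (unsplittable→irreducible unsplit) z₀ (trans (sym e) split)

    minimal : ∀ Y Z → IsCTSD X Y Z → ¬ (depth Z < depth Z₀)
    minimal Y Z c = <-irrefl (cong depth (proj₂ (only Y Z c)))

-- Short-circuit evaluation of the subgrammars

_≟TF_ : DecidableEquality TF
lT ≟TF lT = yes refl
lT ≟TF lF = no (λ ())
lF ≟TF lT = no (λ ())
lF ≟TF lF = yes refl

open Substitution _≟TF_

se-∧ : ∀ P Q → se (P ∧° Q) ≡ sub lT (se Q) (se P)
se-∧ P Q = replace-ext (se P) λ { lT → refl ; lF → refl }

se-∨ : ∀ P Q → se (P ∨° Q) ≡ sub lF (se Q) (se P)
se-∨ P Q = replace-ext (se P) λ { lT → refl ; lF → refl }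

T-term-leaves : ∀ {P m} → TTerm P → HasLeaf m (se P) → m ≡ lT
T-term-leaves tT here = refl
T-term-leaves (tStep a {P} p q) (inl h) = leaf-of-leaf (replace-uniform (se P) _ (T-term-leaves p) h)
T-term-leaves (tStep a p q) (inr h) = T-term-leaves q h

-- The last disjunct of a T-term ends in the leaf T.
T-term-has-T : ∀ {P} → TTerm P → HasLeaf lT (se P)
T-term-has-T tT = here
T-term-has-T (tStep a p q) = inr (T-term-has-T q)

F-term-leaves : ∀ {P m} → FTerm P → HasLeaf m (se P) → m ≡ lF
F-term-leaves fF here = refl
F-term-leaves (fStep a {P} p q) (inr h) = leaf-of-leaf (replace-uniform (se P) _ (F-term-leaves p) h)
F-term-leaves (fStep a p q) (inl h) = F-term-leaves q h

-- The last conjunct of an F-term ends in the leaf F.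
F-term-has-F : ∀ {P} → FTerm P → HasLeaf lF (se P)
F-term-has-F fF = here
F-term-has-F (fStep a p q) = inl (F-term-has-F q)

T-term-replace : ∀ {P} (σ : TF → 𝒯) → σ lT ≡ leaf lT → TTerm P → replace (se P) σ ≡ se P
T-term-replace σ σT p = replace-identity _ σ (λ h → subst (λ m → σ m ≡ leaf m) (sym (T-term-leaves p h)) σT)

-- se of an ℓ-term is a node with a T-only child (se of the T-term) and an
-- F-only child (se of the F-term), so it is full and irreducible.
ℓ-term-full-irreducible : ∀ {P} → LTerm P → FullIrreducible (se P)
ℓ-term-full-irreducible (lPos a {P} {Q} p q) = subst FullIrreducible (sym shape)
  ((λ { lT → inl (T-term-has-T p) ; lF → inr (F-term-has-F q) }) ,
   separated {a = a} (λ ()) (T-term-leaves p) (F-term-leaves q))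
  where
    shape : se ((atom a ∧° P) ∨° Q) ≡ node (se P) a (se Q)
    shape = cong (λ t → node t a (se Q)) (T-term-replace _ refl p)
ℓ-term-full-irreducible (lNeg a {P} {Q} p q) = subst FullIrreducible (sym shape)
  ((λ { lT → inr (T-term-has-T p) ; lF → inl (F-term-has-F q) }) ,
   separated {a = a} (λ ()) (F-term-leaves q) (T-term-leaves p))
  where
    shape : se ((¬' (atom a) ∧° P) ∨° Q) ≡ node (se Q) a (se P)
    shape = cong (node (se Q) a) (T-term-replace _ refl p)

-- se of a *-term is full and irreducible: ℓ-terms are the base case and
-- ∧°/∨° are substitutions of full irreducible trees.
mutual
  star-full-irreducible : ∀ {P} → StarTerm P → FullIrreducible (se P)
  star-full-irreducible (sC c) = c-full-irreducible c
  star-full-irreducible (sD d) = d-full-irreducible d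

  c-full-irreducible : ∀ {P} → CTerm P → FullIrreducible (se P)
  c-full-irreducible (cL l) = ℓ-term-full-irreducible l
  c-full-irreducible (cAnd {P} {Q} s d) = subst FullIrreducible (sym (se-∧ P Q))
    (sub-full-irreducible {lT} {se Q} (se P) (star-full-irreducible s) (d-full-irreducible d))

  d-full-irreducible : ∀ {P} → DTerm P → FullIrreducible (se P)
  d-full-irreducible (dL l) = ℓ-term-full-irreducible l
  d-full-irreducible (dOr {P} {Q} s c) = subst FullIrreducible (sym (se-∨ P Q))
    (sub-full-irreducible {lF} {se Q} (se P) (star-full-irreducible s) (c-full-irreducible c))

boxed-sub : ∀ X Z → (X [T↦□]) [□↦ Z ] ≡ sub lT Z X
boxed-sub (leaf lT) Z = refl
boxed-sub (leaf lF) Z = refl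
boxed-sub (node X a Y) Z = cong₂ (λ u v → node u a v) (boxed-sub X Z) (boxed-sub Y Z)

T-only-boxOnly : ∀ X → (∀ {m} → HasLeaf m X → m ≡ lT) → BoxOnly (X [T↦□])
T-only-boxOnly (leaf lT) _ = box
T-only-boxOnly (leaf lF) only with only here
... | ()
T-only-boxOnly (node X a Y) only =
  join (T-only-boxOnly X (λ h → only (inl h))) (T-only-boxOnly Y (λ h → only (inr h)))

mainTheorem12 : ∀ (P Q : Term) → TTerm P → StarTerm Q →
    IsTSD (se (P ∧° Q)) ((se P) [T↦□]) (se Q) ×
    (∀ Y Z → IsTSD (se (P ∧° Q)) Y Z → (Y ≡ (se P) [T↦□]) × (Z ≡ se Q))
mainTheorem12 P Q tp sq =
  unique-tsd (se (P ∧° Q)) (se P [T↦□]) (se Q)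
    (T-only-boxOnly (se P) (T-term-leaves tp))
    (proj₂ (star-full-irreducible sq))
    (trans (se-∧ P Q) (sym (boxed-sub (se P) (se Q))))
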